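{- Let $p$ be an odd prime and let $G$ be a finite $p$-group of nilpotency class two with $G = \langle a,b \rangle$. Then for all integers $s \ge 1$, $$G^{(p^s)} = \langle a^{p^s},\ b^{p^s},\ [a,b]^{p^s} \rangle.$$
   Context: $[x,y]=x^{ -1}y^{ -1}xy$. For a group $G$ and positive integer $n$, $G^{(n)}$ denotes the subgroup generated by all $n$-th powers $g^n$, $g\in G$. Nilpotency class two means $[[G,G],G]=1$ and $[G,G]\ne 1$. -}

module Defs where

open import Level using (Level; _⊔_)
open import Algebra.Bundles using (Group)
open import Data.Nat using (ℕ; zero; suc)
open import Data.Fin using (Fin)
open import Data.Product using (Σ; ∃; _×_; _,_)
open import Data.Sum using (_⊎_)
open import Relation.Binary.PropositionalEquality using (_≡_)
open import Relation.Nullary using (¬_)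

module GroupDefs {c ℓ : Level} (G : Group c ℓ) where
  open Group G

  pow : Carrier → ℕ → Carrier
  pow g zero = ε
  pow g (suc n) = pow g n ∙ g

  [_,_] : Carrier → Carrier → Carrier
  [ x , y ] = ((x ⁻¹ ∙ y ⁻¹) ∙ x) ∙ y

  Pred : Set (Level.suc (c ⊔ ℓ))
  Pred = Carrier → Set (c ⊔ ℓ)

  data ⟨_⟩ (S : Pred) : Pred where
    gen  : ∀ {x} → S x → ⟨ S ⟩ x
    one  : ⟨ S ⟩ ε
    mul  : ∀ {x y} → ⟨ S ⟩ x → ⟨ S ⟩ y → ⟨ S ⟩ (x ∙ y)
    inv  : ∀ {x} → ⟨ S ⟩ x → ⟨ S ⟩ (x ⁻¹)
    resp : ∀ {x y} → x ≈ y → ⟨ S ⟩ x → ⟨ S ⟩ y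

  _≐_ : Pred → Pred → Set (c ⊔ ℓ)
  S ≐ T = ∀ x → (S x → T x) × (T x → S x)

  Whole : Pred
  Whole _ = Level.Lift (c ⊔ ℓ) Data.Unit.⊤
    where import Data.Unit

  Trivial : Pred
  Trivial x = Level.Lift c (x ≈ ε)

  Comm : Pred → Pred → Pred
  Comm H K = ⟨ (λ x → Σ Carrier λ h → Σ Carrier λ k → H h × K k × (x ≈ [ h , k ])) ⟩

  PowSub : ℕ → Pred
  PowSub n = ⟨ (λ x → Σ Carrier λ g → x ≈ pow g n) ⟩

  record HasOrder (n : ℕ) : Set (c ⊔ ℓ) where
    field
      enum      : Fin n → Carrier
      enum-inj  : ∀ {i j} → enum i ≈ enum j → i ≡ j
      enum-surj : ∀ x → Σ (Fin n) λ i → enum i ≈ x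

  IsFinitePGroup : ℕ → Set (c ⊔ ℓ)
  IsFinitePGroup p = Σ ℕ λ k → HasOrder (p Data.Nat.^ k)

  ClassTwo : Set (c ⊔ ℓ)
  ClassTwo = (Comm (Comm Whole Whole) Whole ≐ Trivial) × ¬ (Comm Whole Whole ≐ Trivial)

  ⦅_,_⦆ : Carrier → Carrier → Pred
  ⦅ a , b ⦆ x = Level.Lift c ((x ≈ a) ⊎ (x ≈ b))

  ⦅_,_,_⦆ : Carrier → Carrier → Carrier → Pred
  ⦅ a , b , d ⦆ x = Level.Lift c ((x ≈ a) ⊎ ((x ≈ b) ⊎ (x ≈ d)))

{-# OPTIONS --safe #-}
module Submission where

-- When commutators are central, (xy)ⁿ = xⁿ yⁿ [y,x]^(n C 2); for odd n the exponent n C 2 is a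
-- multiple of n, so (xy)ⁿ lies in ⟨xⁿ, yⁿ, [y,x]ⁿ⟩. In G = ⟨a,b⟩ every commutator lies in the
-- central subgroup ⟨[a,b]⟩, on which n-th powering is a homomorphism, so [y,x]ⁿ ∈ ⟨[a,b]ⁿ⟩, and
-- induction on words in a and b puts every gⁿ in ⟨aⁿ, bⁿ, [a,b]ⁿ⟩.

open import Defs
open import Level using (Level; _⊔_; Lift; lift; lower)
open import Algebra.Bundles using (Group)
open import Data.Nat using (ℕ; zero; suc; _+_; _*_; _^_; _≤_)
open import Data.Nat.Properties using (+-comm; *-distribʳ-+; *-cancelʳ-≡)
open import Data.Nat.Divisibility using (_∣_; _∤_; divides; _∣0; ∣1⇒≡1; ∣-refl; ∣m∣n⇒∣m+n)
open import Data.Nat.Primality using (Prime; euclidsLemma; prime[2])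
open import Data.Nat.Combinatorics using (_C_; nC1≡n; nCk+nC[k+1]≡[n+1]C[k+1])
open import Data.Nat.Tactic.RingSolver using () renaming (solve to solve-ℕ)
open import Data.List using (_∷_; [])
-- Pairing is renamed because `_,_` would make `⦅ x , y ⦆` and `[ x , y ]` ambiguous.
open import Data.Product using (Σ; ∃-syntax; proj₁) renaming (_,_ to _&_)
open import Data.Sum using (inj₁; inj₂; [_,_]′)
open import Function using (_∘_)
open import Relation.Binary.PropositionalEquality using (_≡_; cong; module ≡-Reasoning)
import Relation.Binary.PropositionalEquality as ≡
open import Relation.Nullary using (¬_; contradiction)
open import Tactic.MonoidSolver using (solve)

2∤⇒≡1+m*2 : ∀ n → 2 ∤ n → ∃[ m ] n ≡ 1 + m * 2
2∤⇒≡1+m*2 0 2∤0 = contradiction (2 ∣0) 2∤0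
2∤⇒≡1+m*2 1 _ = 0 & ≡.refl
2∤⇒≡1+m*2 (suc (suc n)) 2∤n+2 with 2∤⇒≡1+m*2 n (2∤n+2 ∘ ∣m∣n⇒∣m+n ∣-refl)
... | m & n≡1+m*2 = suc m & cong (2 +_) n≡1+m*2

2∤^ : ∀ {p} s → 2 ∤ p → 2 ∤ p ^ s
2∤^ zero _ 2∣1 = contradiction (∣1⇒≡1 2∣1) λ ()
2∤^ {p} (suc s) 2∤p 2∣p^[1+s] = [ 2∤p , 2∤^ s 2∤p ]′ (euclidsLemma p (p ^ s) prime[2] 2∣p^[1+s])

n+nC2≡[1+n]C2 : ∀ n → n + n C 2 ≡ suc n C 2
n+nC2≡[1+n]C2 n = ≡.trans (cong (_+ n C 2) (≡.sym (nC1≡n n))) (nCk+nC[k+1]≡[n+1]C[k+1] n 1)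

[1+n]C2*2≡[1+n]*n : ∀ n → (suc n C 2) * 2 ≡ suc n * n
[1+n]C2*2≡[1+n]*n zero = ≡.refl
[1+n]C2*2≡[1+n]*n (suc n) = begin
  (suc (suc n) C 2) * 2      ≡⟨ cong (_* 2) (n+nC2≡[1+n]C2 (suc n)) ⟨
  (suc n + suc n C 2) * 2    ≡⟨ *-distribʳ-+ 2 (suc n) (suc n C 2) ⟩
  suc n * 2 + (suc n C 2) * 2 ≡⟨ cong (suc n * 2 +_) ([1+n]C2*2≡[1+n]*n n) ⟩
  suc n * 2 + suc n * n      ≡⟨ solve-ℕ (n ∷ []) ⟩
  suc (suc n) * suc n        ∎
  where open ≡-Reasoning

2∤⇒∣C2 : ∀ {n} → 2 ∤ n → n ∣ n C 2
2∤⇒∣C2 {n} 2∤n with 2∤⇒≡1+m*2 n 2∤n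
... | m & ≡.refl = divides m (*-cancelʳ-≡ _ _ 2 (begin
  (suc (m * 2) C 2) * 2   ≡⟨ [1+n]C2*2≡[1+n]*n (m * 2) ⟩
  suc (m * 2) * (m * 2)   ≡⟨ solve-ℕ (m ∷ []) ⟩
  m * suc (m * 2) * 2     ∎))
  where open ≡-Reasoning

module GroupLemmas {c ℓ : Level} (G : Group c ℓ) where
  open Group G
  open GroupDefs G
  open import Algebra.Properties.Group G
    using (ε⁻¹≈ε; ⁻¹-anti-homo-∙; inverseʳ-unique; \\-leftDividesˡ; \\-leftDividesʳ)
  open import Algebra.Properties.Monoid monoid using (ε-comm; cancelˡ; cancelʳ; insertʳ)
  open import Algebra.Properties.Monoid.Mult monoid using (_×_; ×-homo-1; ×-homo-+; ×-congʳ; ×-congˡ; ×-assocˡ)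
  open import Relation.Binary.Reasoning.Setoid setoid

  pow≈× : ∀ g n → pow g n ≈ n × g
  pow≈× g zero = refl
  pow≈× g (suc n) = begin
    pow g n ∙ g      ≈⟨ ∙-cong (pow≈× g n) (sym (×-homo-1 g)) ⟩
    n × g ∙ 1 × g    ≈⟨ ×-homo-+ g n 1 ⟨
    (n + 1) × g      ≈⟨ ×-congˡ (+-comm n 1) ⟩
    suc n × g        ∎

  pow-cong : ∀ {x y} n → x ≈ y → pow x n ≈ pow y n
  pow-cong {x} {y} n x≈y = begin
    pow x n  ≈⟨ pow≈× x n ⟩
    n × x    ≈⟨ ×-congʳ n x≈y ⟩
    n × y    ≈⟨ pow≈× y n ⟨
    pow y n  ∎

  pow-+ : ∀ g m n → pow g (m + n) ≈ pow g m ∙ pow g n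
  pow-+ g m n = begin
    pow g (m + n)        ≈⟨ pow≈× g (m + n) ⟩
    (m + n) × g          ≈⟨ ×-homo-+ g m n ⟩
    m × g ∙ n × g        ≈⟨ ∙-cong (pow≈× g m) (pow≈× g n) ⟨
    pow g m ∙ pow g n    ∎

  pow-* : ∀ g m n → pow g (m * n) ≈ pow (pow g n) m
  pow-* g m n = begin
    pow g (m * n)      ≈⟨ pow≈× g (m * n) ⟩
    (m * n) × g        ≈⟨ ×-assocˡ g m n ⟨
    m × (n × g)        ≈⟨ ×-congʳ m (pow≈× g n) ⟨
    m × pow g n        ≈⟨ pow≈× (pow g n) m ⟨
    pow (pow g n) m    ∎

  pow-sucˡ : ∀ g n → pow g (suc n) ≈ g ∙ pow g n
  pow-sucˡ g n = trans (pow≈× g (suc n)) (∙-congˡ (sym (pow≈× g n)))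

  pow-ε : ∀ n → pow ε n ≈ ε
  pow-ε zero = refl
  pow-ε (suc n) = trans (identityʳ _) (pow-ε n)

  pow-⁻¹ : ∀ g n → pow (g ⁻¹) n ≈ pow g n ⁻¹
  pow-⁻¹ g zero = sym ε⁻¹≈ε
  pow-⁻¹ g (suc n) = begin
    pow (g ⁻¹) n ∙ g ⁻¹    ≈⟨ ∙-congʳ (pow-⁻¹ g n) ⟩
    pow g n ⁻¹ ∙ g ⁻¹      ≈⟨ ⁻¹-anti-homo-∙ g (pow g n) ⟨
    (g ∙ pow g n) ⁻¹       ≈⟨ ⁻¹-cong (pow-sucˡ g n) ⟨
    pow g (suc n) ⁻¹       ∎

  Commute : Carrier → Carrier → Set ℓ
  Commute x y = x ∙ y ≈ y ∙ x

  Central : Carrier → Set (c ⊔ ℓ)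
  Central z = ∀ y → Commute z y

  commute-εˡ : ∀ y → Commute ε y
  commute-εˡ y = sym (ε-comm y)

  commute-∙ˡ : ∀ {x y z} → Commute x z → Commute y z → Commute (x ∙ y) z
  commute-∙ˡ {x} {y} {z} xz≈zx yz≈zy = begin
    (x ∙ y) ∙ z    ≈⟨ assoc x y z ⟩
    x ∙ (y ∙ z)    ≈⟨ ∙-congˡ yz≈zy ⟩
    x ∙ (z ∙ y)    ≈⟨ assoc x z y ⟨
    (x ∙ z) ∙ y    ≈⟨ ∙-congʳ xz≈zx ⟩
    (z ∙ x) ∙ y    ≈⟨ assoc z x y ⟩
    z ∙ (x ∙ y)    ∎

  commute-⁻¹ˡ : ∀ {x y} → Commute x y → Commute (x ⁻¹) y
  commute-⁻¹ˡ {x} {y} xy≈yx = begin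
    x ⁻¹ ∙ y                  ≈⟨ ∙-congˡ (insertʳ (inverseʳ x) y) ⟩
    x ⁻¹ ∙ ((y ∙ x) ∙ x ⁻¹)   ≈⟨ ∙-congˡ (∙-congʳ xy≈yx) ⟨
    x ⁻¹ ∙ ((x ∙ y) ∙ x ⁻¹)   ≈⟨ ∙-congˡ (assoc x y (x ⁻¹)) ⟩
    x ⁻¹ ∙ (x ∙ (y ∙ x ⁻¹))   ≈⟨ cancelˡ (inverseˡ x) (y ∙ x ⁻¹) ⟩
    y ∙ x ⁻¹                  ∎

  commute-powˡ : ∀ {x y} n → Commute x y → Commute (pow x n) y
  commute-powˡ {y = y} zero    xy≈yx = commute-εˡ y
  commute-powˡ         (suc n) xy≈yx = commute-∙ˡ (commute-powˡ n xy≈yx) xy≈yx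

  central-resp : ∀ {z z′} → z ≈ z′ → Central z → Central z′
  central-resp z≈z′ central-z y = trans (∙-congʳ (sym z≈z′)) (trans (central-z y) (∙-congˡ z≈z′))

  central-pow : ∀ {z} n → Central z → Central (pow z n)
  central-pow n central-z y = commute-powˡ n (central-z y)

  pow-∙-commute : ∀ {x y} n → Commute x y → pow (x ∙ y) n ≈ pow x n ∙ pow y n
  pow-∙-commute zero xy≈yx = sym (identityʳ ε)
  pow-∙-commute {x} {y} (suc n) xy≈yx = begin
    pow (x ∙ y) n ∙ (x ∙ y)    ≈⟨ ∙-congʳ (pow-∙-commute n xy≈yx) ⟩
    (X ∙ Y) ∙ (x ∙ y)          ≈⟨ solve monoid ⟩
    X ∙ (Y ∙ x) ∙ y            ≈⟨ ∙-congʳ (∙-congˡ (commute-powˡ n (sym xy≈yx))) ⟩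
    X ∙ (x ∙ Y) ∙ y            ≈⟨ solve monoid ⟩
    (X ∙ x) ∙ (Y ∙ y)          ∎
    where
    X Y : Carrier
    X = pow x n
    Y = pow y n

  central-closed : ∀ {S : Pred} → (∀ {z} → S z → Central z) → ∀ {z} → ⟨ S ⟩ z → Central z
  central-closed S-central (gen s)      = S-central s
  central-closed S-central one          = commute-εˡ
  central-closed S-central (mul p q)  y =
    commute-∙ˡ (central-closed S-central p y) (central-closed S-central q y)
  central-closed S-central (inv p)    y = commute-⁻¹ˡ (central-closed S-central p y)
  central-closed S-central (resp e p)   = central-resp e (central-closed S-central p)

  ｛_｝ : Carrier → Pred
  ｛ z ｝ x = Lift c (x ≈ z)

  ⟨⟩-least : ∀ {S T : Pred} → (∀ {x} → S x → ⟨ T ⟩ x) → ∀ {x} → ⟨ S ⟩ x → ⟨ T ⟩ x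
  ⟨⟩-least S⊆⟨T⟩ (gen s)    = S⊆⟨T⟩ s
  ⟨⟩-least S⊆⟨T⟩ one        = one
  ⟨⟩-least S⊆⟨T⟩ (mul p q)  = mul (⟨⟩-least S⊆⟨T⟩ p) (⟨⟩-least S⊆⟨T⟩ q)
  ⟨⟩-least S⊆⟨T⟩ (inv p)    = inv (⟨⟩-least S⊆⟨T⟩ p)
  ⟨⟩-least S⊆⟨T⟩ (resp e p) = resp e (⟨⟩-least S⊆⟨T⟩ p)

  pow-∈ : ∀ {S x} n → ⟨ S ⟩ x → ⟨ S ⟩ (pow x n)
  pow-∈ zero    x∈ = one
  pow-∈ (suc n) x∈ = mul (pow-∈ n x∈) x∈

  pow-closed-central : ∀ {S T : Pred} n → (∀ {z} → S z → Central z) →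
    (∀ {z} → S z → ⟨ T ⟩ (pow z n)) → ∀ {z} → ⟨ S ⟩ z → ⟨ T ⟩ (pow z n)
  pow-closed-central {S} {T} n S-central S^n⊆⟨T⟩ = go
    where
    go : ∀ {z} → ⟨ S ⟩ z → ⟨ T ⟩ (pow z n)
    go (gen s)            = S^n⊆⟨T⟩ s
    go one                = resp (sym (pow-ε n)) one
    go (mul {y = y} p q)  =
      resp (sym (pow-∙-commute n (central-closed S-central p y))) (mul (go p) (go q))
    go (inv {x} p)        = resp (sym (pow-⁻¹ x n)) (inv (go p))
    go (resp e p)         = resp (pow-cong n e) (go p)

  [x,y]≈[y∙x]⁻¹∙[x∙y] : ∀ x y → [ x , y ] ≈ (y ∙ x) ⁻¹ ∙ (x ∙ y)
  [x,y]≈[y∙x]⁻¹∙[x∙y] x y = begin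
    ((x ⁻¹ ∙ y ⁻¹) ∙ x) ∙ y   ≈⟨ solve monoid ⟩
    (x ⁻¹ ∙ y ⁻¹) ∙ (x ∙ y)   ≈⟨ ∙-congʳ (⁻¹-anti-homo-∙ y x) ⟨
    (y ∙ x) ⁻¹ ∙ (x ∙ y)      ∎

  x∙y≈y∙x∙[x,y] : ∀ x y → x ∙ y ≈ (y ∙ x) ∙ [ x , y ]
  x∙y≈y∙x∙[x,y] x y = begin
    x ∙ y                             ≈⟨ \\-leftDividesˡ (y ∙ x) (x ∙ y) ⟨
    (y ∙ x) ∙ ((y ∙ x) ⁻¹ ∙ (x ∙ y))  ≈⟨ ∙-congˡ ([x,y]≈[y∙x]⁻¹∙[x∙y] x y) ⟨
    (y ∙ x) ∙ [ x , y ]               ∎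

  [,]-unique : ∀ {x y w} → x ∙ y ≈ (y ∙ x) ∙ w → [ x , y ] ≈ w
  [,]-unique {x} {y} {w} xy≈yxw = begin
    [ x , y ]                   ≈⟨ [x,y]≈[y∙x]⁻¹∙[x∙y] x y ⟩
    (y ∙ x) ⁻¹ ∙ (x ∙ y)        ≈⟨ ∙-congˡ xy≈yxw ⟩
    (y ∙ x) ⁻¹ ∙ ((y ∙ x) ∙ w)  ≈⟨ \\-leftDividesʳ (y ∙ x) w ⟩
    w                           ∎

  [,]-cong : ∀ {x x′ y y′} → x ≈ x′ → y ≈ y′ → [ x , y ] ≈ [ x′ , y′ ]
  [,]-cong x≈x′ y≈y′ = ∙-cong (∙-cong (∙-cong (⁻¹-cong x≈x′) (⁻¹-cong y≈y′)) x≈x′) y≈y′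

  commute⇒[,]≈ε : ∀ {x y} → Commute x y → [ x , y ] ≈ ε
  commute⇒[,]≈ε xy≈yx = [,]-unique (trans xy≈yx (sym (identityʳ _)))

  [x,x]≈ε : ∀ x → [ x , x ] ≈ ε
  [x,x]≈ε x = commute⇒[,]≈ε refl

  [ε,x]≈ε : ∀ x → [ ε , x ] ≈ ε
  [ε,x]≈ε x = commute⇒[,]≈ε (commute-εˡ x)

  [,]≈ε⇒commute : ∀ {x y} → [ x , y ] ≈ ε → Commute x y
  [,]≈ε⇒commute {x} {y} [x,y]≈ε = begin
    x ∙ y                ≈⟨ x∙y≈y∙x∙[x,y] x y ⟩
    (y ∙ x) ∙ [ x , y ]  ≈⟨ ∙-congˡ [x,y]≈ε ⟩
    (y ∙ x) ∙ ε          ≈⟨ identityʳ (y ∙ x) ⟩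
    y ∙ x                ∎

  [,]-anti : ∀ x y → [ y , x ] ≈ [ x , y ] ⁻¹
  [,]-anti x y = [,]-unique (begin
    y ∙ x                                 ≈⟨ cancelʳ (inverseʳ [ x , y ]) (y ∙ x) ⟨
    ((y ∙ x) ∙ [ x , y ]) ∙ [ x , y ] ⁻¹  ≈⟨ ∙-congʳ (x∙y≈y∙x∙[x,y] x y) ⟨
    (x ∙ y) ∙ [ x , y ] ⁻¹                ∎)

  classTwo⇒[,]-central : ClassTwo → ∀ x y → Central [ x , y ]
  classTwo⇒[,]-central (Γ₃≐1 & _) x y z = [,]≈ε⇒commute (lower (proj₁ (Γ₃≐1 [ [ x , y ] , z ])
    (gen ([ x , y ] & z & gen (x & y & _ & _ & refl) & _ & refl))))

  module CentralCommutators ([,]-central : ∀ x y → Central [ x , y ]) where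

    [,]-∙ˡ : ∀ x y z → [ x ∙ y , z ] ≈ [ x , z ] ∙ [ y , z ]
    [,]-∙ˡ x y z = [,]-unique (begin
      (x ∙ y) ∙ z                               ≈⟨ assoc x y z ⟩
      x ∙ (y ∙ z)                               ≈⟨ ∙-congˡ (x∙y≈y∙x∙[x,y] y z) ⟩
      x ∙ ((z ∙ y) ∙ [ y , z ])                 ≈⟨ solve monoid ⟩
      (x ∙ z) ∙ (y ∙ [ y , z ])                 ≈⟨ ∙-congʳ (x∙y≈y∙x∙[x,y] x z) ⟩
      ((z ∙ x) ∙ [ x , z ]) ∙ (y ∙ [ y , z ])   ≈⟨ solve monoid ⟩
      (z ∙ x) ∙ (([ x , z ] ∙ y) ∙ [ y , z ])   ≈⟨ ∙-congˡ (∙-congʳ ([,]-central x z y)) ⟩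
      (z ∙ x) ∙ ((y ∙ [ x , z ]) ∙ [ y , z ])   ≈⟨ solve monoid ⟩
      (z ∙ (x ∙ y)) ∙ ([ x , z ] ∙ [ y , z ])   ∎)

    [,]-⁻¹ˡ : ∀ x y → [ x ⁻¹ , y ] ≈ [ x , y ] ⁻¹
    [,]-⁻¹ˡ x y = inverseʳ-unique [ x , y ] [ x ⁻¹ , y ] (begin
      [ x , y ] ∙ [ x ⁻¹ , y ]  ≈⟨ [,]-∙ˡ x (x ⁻¹) y ⟨
      [ x ∙ x ⁻¹ , y ]          ≈⟨ [,]-cong (inverseʳ x) refl ⟩
      [ ε , y ]                 ≈⟨ [ε,x]≈ε y ⟩
      ε                         ∎)

    [pow,]≈pow[,] : ∀ x y n → [ pow x n , y ] ≈ pow [ x , y ] n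
    [pow,]≈pow[,] x y zero    = [ε,x]≈ε y
    [pow,]≈pow[,] x y (suc n) = trans ([,]-∙ˡ (pow x n) x y) (∙-congʳ ([pow,]≈pow[,] x y n))

    pow-∙ : ∀ x y n → pow (x ∙ y) n ≈ (pow x n ∙ pow y n) ∙ pow [ y , x ] (n C 2)
    pow-∙ x y zero    = solve monoid
    pow-∙ x y (suc n) = begin
      pow (x ∙ y) n ∙ (x ∙ y)                ≈⟨ ∙-congʳ (pow-∙ x y n) ⟩
      ((X ∙ Y) ∙ cᵀ) ∙ (x ∙ y)               ≈⟨ assoc (X ∙ Y) cᵀ (x ∙ y) ⟩
      (X ∙ Y) ∙ (cᵀ ∙ (x ∙ y))               ≈⟨ ∙-congˡ (central-pow (n C 2) c-central (x ∙ y)) ⟩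
      (X ∙ Y) ∙ ((x ∙ y) ∙ cᵀ)               ≈⟨ solve monoid ⟩
      (X ∙ (Y ∙ x) ∙ y) ∙ cᵀ                 ≈⟨ ∙-congʳ (∙-congʳ (∙-congˡ (x∙y≈y∙x∙[x,y] Y x))) ⟩
      (X ∙ ((x ∙ Y) ∙ [ Y , x ]) ∙ y) ∙ cᵀ   ≈⟨ ∙-congʳ (∙-congʳ (∙-congˡ (∙-congˡ ([pow,]≈pow[,] y x n)))) ⟩
      (X ∙ ((x ∙ Y) ∙ cⁿ) ∙ y) ∙ cᵀ          ≈⟨ solve monoid ⟩
      ((X ∙ x) ∙ Y) ∙ ((cⁿ ∙ y) ∙ cᵀ)        ≈⟨ ∙-congˡ (∙-congʳ (central-pow n c-central y)) ⟩
      ((X ∙ x) ∙ Y) ∙ ((y ∙ cⁿ) ∙ cᵀ)        ≈⟨ solve monoid ⟩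
      ((X ∙ x) ∙ (Y ∙ y)) ∙ (cⁿ ∙ cᵀ)        ≈⟨ ∙-congˡ (pow-+ [ y , x ] n (n C 2)) ⟨
      ((X ∙ x) ∙ (Y ∙ y)) ∙ pow [ y , x ] (n + n C 2)
        ≈⟨ ∙-congˡ (reflexive (cong (pow [ y , x ]) (n+nC2≡[1+n]C2 n))) ⟩
      ((X ∙ x) ∙ (Y ∙ y)) ∙ pow [ y , x ] (suc n C 2) ∎
      where
      X Y cⁿ cᵀ : Carrier
      X  = pow x n
      Y  = pow y n
      cⁿ = pow [ y , x ] n
      cᵀ = pow [ y , x ] (n C 2)
      c-central : Central [ y , x ]
      c-central = [,]-central y x

    [,]-closedˡ : ∀ {S T : Pred} {y} → (∀ {x} → S x → ⟨ T ⟩ [ x , y ]) →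
      ∀ {x} → ⟨ S ⟩ x → ⟨ T ⟩ [ x , y ]
    [,]-closedˡ {S} {T} {y} S⊆ = go
      where
      go : ∀ {x} → ⟨ S ⟩ x → ⟨ T ⟩ [ x , y ]
      go (gen s)            = S⊆ s
      go one                = resp (sym ([ε,x]≈ε y)) one
      go (mul {x} {x′} p q) = resp (sym ([,]-∙ˡ x x′ y)) (mul (go p) (go q))
      go (inv {x} p)        = resp (sym ([,]-⁻¹ˡ x y)) (inv (go p))
      go (resp e p)         = resp ([,]-cong e refl) (go p)

    pow-∙-[,]ᴺ : ∀ x y N k → N C 2 ≡ k * N →
      pow (x ∙ y) N ≈ (pow x N ∙ pow y N) ∙ pow (pow [ y , x ] N) k
    pow-∙-[,]ᴺ x y N k NC2≡k*N = begin
      pow (x ∙ y) N                                  ≈⟨ pow-∙ x y N ⟩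
      (pow x N ∙ pow y N) ∙ pow [ y , x ] (N C 2)    ≈⟨ ∙-congˡ (reflexive (cong (pow [ y , x ]) NC2≡k*N)) ⟩
      (pow x N ∙ pow y N) ∙ pow [ y , x ] (k * N)    ≈⟨ ∙-congˡ (pow-* [ y , x ] k N) ⟩
      (pow x N ∙ pow y N) ∙ pow (pow [ y , x ] N) k  ∎

    pow-closed : ∀ {N} {S T : Pred} → N ∣ N C 2 → (∀ x y → ⟨ T ⟩ (pow [ x , y ] N)) →
      (∀ {x} → S x → ⟨ T ⟩ (pow x N)) → ∀ {x} → ⟨ S ⟩ x → ⟨ T ⟩ (pow x N)
    pow-closed {N} {S} {T} (divides k NC2≡k*N) pow[,]∈ S^N⊆⟨T⟩ = go
      where
      go : ∀ {x} → ⟨ S ⟩ x → ⟨ T ⟩ (pow x N)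
      go (gen s)           = S^N⊆⟨T⟩ s
      go one               = resp (sym (pow-ε N)) one
      go (mul {x} {y} p q) =
        resp (sym (pow-∙-[,]ᴺ x y N k NC2≡k*N)) (mul (mul (go p) (go q)) (pow-∈ k (pow[,]∈ y x)))
      go (inv {x} p)       = resp (sym (pow-⁻¹ x N)) (inv (go p))
      go (resp e p)        = resp (pow-cong N e) (go p)

    module TwoGenerated (a b : Carrier) (generated : ∀ x → ⟨ ⦅ a , b ⦆ ⟩ x) where

      generators-[,]∈ : ∀ {x y} → ⦅ a , b ⦆ x → ⦅ a , b ⦆ y → ⟨ ｛ [ a , b ] ｝ ⟩ [ x , y ]
      generators-[,]∈ (lift (inj₁ x≈a)) (lift (inj₁ y≈a)) =
        resp ([,]-cong (sym x≈a) (sym y≈a)) (resp (sym ([x,x]≈ε a)) one)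
      generators-[,]∈ (lift (inj₁ x≈a)) (lift (inj₂ y≈b)) =
        resp ([,]-cong (sym x≈a) (sym y≈b)) (gen (lift refl))
      generators-[,]∈ (lift (inj₂ x≈b)) (lift (inj₁ y≈a)) =
        resp ([,]-cong (sym x≈b) (sym y≈a)) (resp (sym ([,]-anti a b)) (inv (gen (lift refl))))
      generators-[,]∈ (lift (inj₂ x≈b)) (lift (inj₂ y≈b)) =
        resp ([,]-cong (sym x≈b) (sym y≈b)) (resp (sym ([x,x]≈ε b)) one)

      [,]∈⟨[a,b]⟩ : ∀ x y → ⟨ ｛ [ a , b ] ｝ ⟩ [ x , y ]
      [,]∈⟨[a,b]⟩ x y = [,]-closedˡ [s,y]∈ (generated x)
        where
        [s,y]∈ : ∀ {s} → ⦅ a , b ⦆ s → ⟨ ｛ [ a , b ] ｝ ⟩ [ s , y ]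
        [s,y]∈ {s} s∈ =
          resp (sym ([,]-anti y s)) (inv ([,]-closedˡ (λ t∈ → generators-[,]∈ t∈ s∈) (generated y)))

      PowSub≐ : ∀ {N} → N ∣ N C 2 → PowSub N ≐ ⟨ ⦅ pow a N , pow b N , pow [ a , b ] N ⦆ ⟩
      PowSub≐ {N} N∣NC2 _ = ⟨⟩-least powers∈ & ⟨⟩-least generators∈
        where
        H : Pred
        H = ⦅ pow a N , pow b N , pow [ a , b ] N ⦆

        pow[,]∈ : ∀ x y → ⟨ H ⟩ (pow [ x , y ] N)
        pow[,]∈ x y = pow-closed-central N
          (λ (lift z≈[a,b]) → central-resp (sym z≈[a,b]) ([,]-central a b))
          (λ (lift z≈[a,b]) → resp (pow-cong N (sym z≈[a,b])) (gen (lift (inj₂ (inj₂ refl)))))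
          ([,]∈⟨[a,b]⟩ x y)

        generator^N∈ : ∀ {x} → ⦅ a , b ⦆ x → ⟨ H ⟩ (pow x N)
        generator^N∈ (lift (inj₁ x≈a)) = resp (pow-cong N (sym x≈a)) (gen (lift (inj₁ refl)))
        generator^N∈ (lift (inj₂ x≈b)) = resp (pow-cong N (sym x≈b)) (gen (lift (inj₂ (inj₁ refl))))

        powers∈ : ∀ {x} → (Σ Carrier λ g → x ≈ pow g N) → ⟨ H ⟩ x
        powers∈ (g & x≈g^N) = resp (sym x≈g^N) (pow-closed N∣NC2 pow[,]∈ generator^N∈ (generated g))

        generators∈ : ∀ {x} → H x → PowSub N x
        generators∈ (lift (inj₁ x≈a^N))        = gen (a & x≈a^N)
        generators∈ (lift (inj₂ (inj₁ x≈b^N))) = gen (b & x≈b^N)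
        generators∈ (lift (inj₂ (inj₂ x≈c^N))) = gen ([ a , b ] & x≈c^N)

proposition3p2 : ∀ {c ℓ : Level} (p : ℕ) → Prime p → ¬ (2 ∣ p) →
    (G : Group c ℓ) → let open Group G in let open GroupDefs G in
    IsFinitePGroup p → ClassTwo →
    (a b : Carrier) → Whole ≐ ⟨ ⦅ a , b ⦆ ⟩ →
    (s : ℕ) → 1 ≤ s →
    PowSub (p ^ s) ≐ ⟨ ⦅ pow a (p ^ s) , pow b (p ^ s) , pow [ a , b ] (p ^ s) ⦆ ⟩
proposition3p2 p _ 2∤p G _ classTwo a b Whole≐⟨a,b⟩ s _ =
  TwoGenerated.PowSub≐ a b (λ x → proj₁ (Whole≐⟨a,b⟩ x) _) (2∤⇒∣C2 (2∤^ s 2∤p))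
  where
  open GroupLemmas G
  open CentralCommutators (classTwo⇒[,]-central classTwo)
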